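{- Let $D=(V_1,V_2;A)$ be a split digraph such that every vertex of $V_1$ has out-degree and in-degree at least $3$ in $D$. Let $D^{*}$ be a directed multigraph obtained from $D$ by splitting off at most two pairs at every vertex of $V_1$. If $D^{*}\langle V_2\rangle$ has a strong arc decomposition, then $D$ has a strong arc decomposition.
   Context: Digraphs have no loops and no parallel arcs; directed multigraphs may have parallel arcs but no loops. A digraph is semicomplete if every two distinct vertices are joined by at least one arc. A split digraph $D=(V_1,V_2;A)$ is a digraph whose vertex set is the disjoint union of two non-empty sets $V_1,V_2$ such that $V_1$ is independent and the subdigraph induced by $V_2$ is semicomplete. For $t\in V_1$ and arcs $ut,tv$ with $u\neq v$, splitting off the pair $(ut,tv)$ at $t$ means replacing the arcs $ut,tv$ by a new arc $uv$ (an additional parallel copy if $uv$ already exists); splitting off several pairs at $t$ uses pairwise distinct arcs. $D^{*}\langle V_2\rangle$ denotes the directed multigraph induced by $V_2$ in $D^{*}$. A directed multigraph is strong if there is a directed path from $x$ to $y$ for every ordered pair of distinct vertices; a strong arc decomposition of $(V,A)$ is a partition of $A$ into two sets $A_1,A_2$ such that $(V,A_1)$ and $(V,A_2)$ are both strong. -}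

module Defs where

open import Data.Nat using (ℕ; _≤_; _≥_)
open import Data.Fin using (Fin; _≟_)
open import Data.Fin.Subset using (Subset; _∈_; _∉_)
open import Data.Fin.Subset.Properties using (_∈?_)
open import Data.Product using (_×_; _,_; proj₁; proj₂; ∃; ∃-syntax)
open import Data.Sum using (_⊎_)
open import Data.List using (List; []; _∷_; _++_; filter; length; map; concatMap)
open import Data.List.Membership.Propositional using () renaming (_∈_ to _∈ₗ_)
open import Data.List.Relation.Unary.All using (All)
open import Data.List.Relation.Unary.Unique.Propositional using (Unique)
open import Data.List.Relation.Binary.Permutation.Propositional using (_↭_)
open import Relation.Binary.PropositionalEquality using (_≡_; _≢_)
open import Relation.Nullary using (¬_)

open import Relation.Nullary.Decidable using (_×-dec_; ¬?)
open import Data.Unit using (⊤)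

-- An arc list on the vertex set Fin n.  A directed multigraph is a list
-- of arcs (parallel arcs = repeated entries); a digraph is such a list
-- without repetitions.
Arc : ℕ → Set
Arc n = Fin n × Fin n

Arcs : ℕ → Set
Arcs n = List (Arc n)

Loopless : ∀ {n} → Arcs n → Set
Loopless A = All (λ a → proj₁ a ≢ proj₂ a) A

IsDigraph : ∀ {n} → Arcs n → Set
IsDigraph A = Loopless A × Unique A

data Path {n : ℕ} (L : Arcs n) : Fin n → Fin n → Set where
  here : ∀ {x} → Path L x x
  step : ∀ {x y z} → (x , y) ∈ₗ L → Path L y z → Path L x z

StrongOn : ∀ {n} → (Fin n → Set) → Arcs n → Set
StrongOn {n} S L = ∀ (x y : Fin n) → S x → S y → x ≢ y → Path L x y

HasStrongArcDecomp : ∀ {n} → (Fin n → Set) → Arcs n → Set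
HasStrongArcDecomp {n} S L =
  ∃[ A₁ ] ∃[ A₂ ] ((L ↭ A₁ ++ A₂) × StrongOn S A₁ × StrongOn S A₂)

AllV : ∀ {n} → Fin n → Set
AllV _ = ⊤

outdeg : ∀ {n} → Arcs n → Fin n → ℕ
outdeg A t = length (filter (λ a → proj₁ a ≟ t) A)

indeg : ∀ {n} → Arcs n → Fin n → ℕ
indeg A t = length (filter (λ a → proj₂ a ≟ t) A)

-- Split digraph D = (V₁, V₂; A) with V₂ the complement of V₁.
record IsSplitDigraph {n : ℕ} (V₁ : Subset n) (A : Arcs n) : Set where
  field
    digraph      : IsDigraph A
    V₁-nonempty  : ∃[ x ] x ∈ V₁
    V₂-nonempty  : ∃[ x ] x ∉ V₁
    V₁-indep     : ∀ (u v : Fin n) → (u , v) ∈ₗ A → ¬ (u ∈ V₁ × v ∈ V₁)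
    V₂-semicompl : ∀ (x y : Fin n) → x ∉ V₁ → y ∉ V₁ → x ≢ y →
                   ((x , y) ∈ₗ A) ⊎ ((y , x) ∈ₗ A)

record Splitting (n : ℕ) : Set where
  constructor split
  field
    t u v : Fin n
open Splitting public

removed : ∀ {n} → Splitting n → Arcs n
removed s = (u s , t s) ∷ (t s , v s) ∷ []

added : ∀ {n} → Splitting n → Arc n
added s = (u s , v s)

-- D* (arc list Dstar) is obtained from D (arc list A) by splitting off the
-- pairs in `ss` (with pairwise distinct arcs, enforced by the multiset
-- equation), each at a vertex of V₁ with u ≠ v, and at most two pairs at
-- every vertex of V₁.
SplitOffAtMostTwo : ∀ {n} → Subset n → Arcs n → Arcs n → Set
SplitOffAtMostTwo {n} V₁ A Dstar =
  ∃[ ss ] ∃[ rest ]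
    ( All (λ s → t s ∈ V₁ × u s ≢ v s) ss
    × (A ↭ rest ++ concatMap removed ss)
    × (Dstar ≡ rest ++ map added ss)
    × (∀ (x : Fin n) → x ∈ V₁ → length (filter (λ s → t s ≟ x) ss) ≤ 2) )

inducedV₂ : ∀ {n} → Subset n → Arcs n → Arcs n
inducedV₂ V₁ L = filter (λ a → ¬? (proj₁ a ∈? V₁) ×-dec ¬? (proj₂ a ∈? V₁)) L

InV₂ : ∀ {n} → Subset n → Fin n → Set
InV₂ V₁ x = x ∉ V₁

-- Lift each class of the decomposition of D*⟨V₂⟩ by replacing every split-off arc uv in it by
-- the pair ut, tv it came from: each arc of the class becomes a path in the lifted class, so V₂
-- stays strongly connected there.  As V₁ is independent, it remains to give every t ∈ V₁ an
-- out-arc and an in-arc in both classes.  A class that splits a pair at t has them.  Of the arcs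
-- at t that were not split off there are, in each direction, at least 3 − 2 ≥ 1, and at least 3
-- if no pair is split at t.  So class 1 takes, at each t where it splits nothing, the first
-- unsplit arc in each direction, and class 2 takes all other arcs: where only class 1 splits it
-- gets every unsplit arc, and where nobody splits it still gets a second one.
module Submission where

open import Defs
import Algebra.Properties.CommutativeSemigroup as CommutativeSemigroupProperties
open import Algebra.Bundles using (CommutativeMonoid)
open import Data.Nat using (ℕ; _≤_; _≥_; _+_; suc; s≤s)
open import Data.Nat.Properties using (≤-trans; n≤1+n; +-identityʳ; +-monoʳ-≤; +-cancelʳ-≤)
open import Data.Fin using (Fin; _≟_)
open import Data.Fin.Subset using (Subset; _∈_; _∉_)
open import Data.Fin.Subset.Properties using (_∈?_)
open import Data.Product using (_×_; _,_; proj₁; proj₂; ∃; ∃₂)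
import Data.Product.Properties as Product
open import Data.Sum using (_⊎_; inj₁; inj₂; [_,_])
open import Data.Empty using (⊥-elim)
open import Data.Maybe using (just)
import Data.Maybe.Properties as Maybe
open import Data.List using (List; []; _∷_; _++_; filter; length; map; concatMap; head)
open import Data.List.Properties
  using (++-assoc; ∷-injective; filter-++; filter-all; filter-none; length-++; concatMap-++; partition-defn)
open import Data.List.Membership.Propositional using (find; lose) renaming (_∈_ to _∈ₗ_)
open import Data.List.Membership.Propositional.Properties
  using (∈-++⁻; ∈-++⁺ˡ; ∈-++⁺ʳ; ∈-∃++; ∈-map⁻; ∈-filter⁺; ∈-filter⁻)
open import Data.List.Relation.Unary.Any using (Any; here; there; any?)
import Data.List.Relation.Unary.Any.Properties as Any
open import Data.List.Relation.Unary.All using (All; []; _∷_; tabulate; lookup)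
import Data.List.Relation.Unary.All.Properties as All
open import Data.List.Relation.Unary.AllPairs using ([]; _∷_)
open import Data.List.Relation.Unary.Unique.Propositional using (Unique)
import Data.List.Relation.Unary.Unique.Propositional.Properties as Unique
open import Data.List.Relation.Binary.Permutation.Propositional
  using (_↭_; refl; prep; swap; trans; ↭-refl; ↭-sym; ↭-trans; ↭-reflexive; ↭⇒↭ₛ; ↭ₛ⇒↭;
         module PermutationReasoning)
open import Data.List.Relation.Binary.Permutation.Propositional.Properties
  using (∈-resp-↭; Any-resp-↭; drop-mid; shift; shifts; ↭-map-inv; ↭-length; filter-↭; ++⁺ˡ; ++⁺;
         ++-commutativeMonoid)
import Data.List.Relation.Binary.Permutation.Setoid.Properties as PermutationSetoid
open import Relation.Binary.PropositionalEquality using (_≡_; _≢_; refl; sym; cong; subst; setoid)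
  renaming (trans to ≡-trans)
open import Relation.Nullary using (¬_; Dec; yes; no)
open import Relation.Nullary.Decidable using (_×-dec_; ¬?; _⊎-dec_)
open import Relation.Unary using (Decidable)
open import Relation.Unary.Properties using (∁?)

module _ {A : Set} where

  ++-↭-refine : ∀ (X Y : List A) {B₁ B₂} → X ++ Y ↭ B₁ ++ B₂ →
    ∃₂ λ X₁ X₂ → ∃₂ λ Y₁ Y₂ →
      (X ↭ X₁ ++ X₂) × (Y ↭ Y₁ ++ Y₂) × (B₁ ↭ X₁ ++ Y₁) × (B₂ ↭ X₂ ++ Y₂)
  ++-↭-refine [] Y p = [] , [] , _ , _ , ↭-refl , p , ↭-refl , ↭-refl
  ++-↭-refine (x ∷ X) Y {B₁} {B₂} p with ∈-++⁻ B₁ (∈-resp-↭ p (here refl))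
  ... | inj₁ x∈B₁ with ys , zs , refl ← ∈-∃++ x∈B₁
    with X₁ , X₂ , Y₁ , Y₂ , pX , pY , p₁ , p₂ ← ++-↭-refine X Y
           (↭-trans (drop-mid [] ys (↭-trans p (↭-reflexive (++-assoc ys (x ∷ zs) B₂))))
                    (↭-reflexive (sym (++-assoc ys zs B₂))))
    = x ∷ X₁ , X₂ , Y₁ , Y₂ , prep x pX , pY , ↭-trans (shift x ys zs) (prep x p₁) , p₂
  ++-↭-refine (x ∷ X) Y {B₁} {B₂} p | inj₂ x∈B₂ with ys , zs , refl ← ∈-∃++ x∈B₂
    with X₁ , X₂ , Y₁ , Y₂ , pX , pY , p₁ , p₂ ← ++-↭-refine X Y
           (↭-trans (drop-mid [] (B₁ ++ ys) (↭-trans p (↭-reflexive (sym (++-assoc B₁ ys (x ∷ zs))))))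
                    (↭-reflexive (++-assoc B₁ ys zs)))
    = X₁ , x ∷ X₂ , Y₁ , Y₂ , ↭-trans (prep x pX) (↭-sym (shift x X₁ X₂)) , pY , p₁ ,
      ↭-trans (shift x ys zs) (prep x p₂)

  Unique-++⁻ˡ : ∀ xs {ys : List A} → Unique (xs ++ ys) → Unique xs
  Unique-++⁻ˡ [] _ = []
  Unique-++⁻ˡ (x ∷ xs) (x∉ ∷ u) = All.++⁻ˡ xs x∉ ∷ Unique-++⁻ˡ xs u

  Unique-resp-↭ : {xs ys : List A} → xs ↭ ys → Unique xs → Unique ys
  Unique-resp-↭ p = PermutationSetoid.Unique-resp-↭ (setoid A) (↭⇒↭ₛ p)

  ↭-filter-partition : ∀ {P : A → Set} (P? : Decidable P) xs → xs ↭ filter P? xs ++ filter (∁? P?) xs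
  ↭-filter-partition P? xs =
    subst (λ (ys , zs) → xs ↭ ys ++ zs) (partition-defn P? xs)
      (↭ₛ⇒↭ (PermutationSetoid.partition-↭ (setoid A) P? xs))

  head-∈ : ∀ (xs : List A) → length xs ≥ 1 → ∃ λ a → head xs ≡ just a × a ∈ₗ xs
  head-∈ (a ∷ _) _ = a , refl , here refl

  second-∉-head : ∀ (xs : List A) → Unique xs → length xs ≥ 2 →
    ∃₂ λ a b → head xs ≡ just a × b ∈ₗ xs × a ≢ b
  second-∉-head (_ ∷ []) _ (s≤s ())
  second-∉-head (a ∷ b ∷ _) ((a≢b ∷ _) ∷ _) _ = a , b , refl , there (here refl) , a≢b

  open CommutativeSemigroupProperties
    (CommutativeMonoid.commutativeSemigroup (++-commutativeMonoid {A = A}))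
    using (interchange) public

module _ {A B : Set} (f : A → B) where

  map-≡-++ : ∀ xs ys {zs} → map f xs ≡ ys ++ zs →
    ∃₂ λ xs₁ xs₂ → xs ≡ xs₁ ++ xs₂ × ys ≡ map f xs₁ × zs ≡ map f xs₂
  map-≡-++ xs [] refl = [] , xs , refl , refl , refl
  map-≡-++ (x ∷ xs) (y ∷ ys) eq with refl , eq′ ← ∷-injective eq
    with xs₁ , xs₂ , refl , refl , refl ← map-≡-++ xs ys eq′
    = x ∷ xs₁ , xs₂ , refl , refl , refl

  ++-map-↭-refine : ∀ (X : List B) (S : List A) {B₁ B₂} → X ++ map f S ↭ B₁ ++ B₂ →
    ∃₂ λ X₁ X₂ → ∃₂ λ S₁ S₂ →
      (X ↭ X₁ ++ X₂) × (S ↭ S₁ ++ S₂) × (B₁ ↭ X₁ ++ map f S₁) × (B₂ ↭ X₂ ++ map f S₂)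
  ++-map-↭-refine X S p
    with X₁ , X₂ , Y₁ , Y₂ , pX , pY , p₁ , p₂ ← ++-↭-refine X (map f S) p
    with S′ , Y₁++Y₂≡fS′ , pS ← ↭-map-inv f pY
    with S₁ , S₂ , refl , refl , refl ← map-≡-++ S′ Y₁ (sym Y₁++Y₂≡fS′)
    = X₁ , X₂ , S₁ , S₂ , pX , pS , p₁ , p₂

module _ {A B : Set} (f : A → List B) where

  concatMap-↭ : {xs ys : List A} → xs ↭ ys → concatMap f xs ↭ concatMap f ys
  concatMap-↭ refl = ↭-refl
  concatMap-↭ (prep x p) = ++⁺ˡ (f x) (concatMap-↭ p)
  concatMap-↭ (swap x y p) = ↭-trans (shifts (f x) (f y)) (++⁺ˡ (f y) (++⁺ˡ (f x) (concatMap-↭ p)))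
  concatMap-↭ (trans p q) = ↭-trans (concatMap-↭ p) (concatMap-↭ q)

module _ {n : ℕ} where

  _++ₚ_ : ∀ {L : Arcs n} {x y z} → Path L x y → Path L y z → Path L x z
  here ++ₚ q = q
  step e p ++ₚ q = step e (p ++ₚ q)

  bindPath : ∀ {L M : Arcs n} → (∀ {x y} → (x , y) ∈ₗ L → Path M x y) →
    ∀ {x y} → Path L x y → Path M x y
  bindPath f here = here
  bindPath f (step e p) = f e ++ₚ bindPath f p

  StrongOn⇒Path : ∀ {S : Fin n → Set} {L : Arcs n} → StrongOn S L →
    ∀ {x y} → S x → S y → Path L x y
  StrongOn⇒Path strong {x} {y} sx sy with x ≟ y
  ... | yes refl = here
  ... | no x≢y = strong x y sx sy x≢y

data Direction : Set where
  outgoing incoming : Direction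

module _ {n : ℕ} where

  endpoint : Direction → Arc n → Fin n
  endpoint outgoing = proj₁
  endpoint incoming = proj₂

  arcsAt : Direction → Fin n → Arcs n → Arcs n
  arcsAt d x = filter (λ a → endpoint d a ≟ x)

  arcsAt⁻ : ∀ d {x a} L → a ∈ₗ arcsAt d x L → a ∈ₗ L × endpoint d a ≡ x
  arcsAt⁻ d {x} L = ∈-filter⁻ (λ a → endpoint d a ≟ x) {xs = L}

  endpoint-unique : ∀ {P : Fin n → Set} {a : Arc n} → ¬ (P (proj₁ a) × P (proj₂ a)) →
    ∀ d d′ → P (endpoint d a) → P (endpoint d′ a) → d ≡ d′
  endpoint-unique _ outgoing outgoing _ _ = refl
  endpoint-unique _ incoming incoming _ _ = refl
  endpoint-unique notBoth outgoing incoming p q = ⊥-elim (notBoth (p , q))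
  endpoint-unique notBoth incoming outgoing p q = ⊥-elim (notBoth (q , p))

  removedArcs : List (Splitting n) → Arcs n
  removedArcs = concatMap removed

  splitCount : List (Splitting n) → Fin n → ℕ
  splitCount S x = length (filter (λ s → t s ≟ x) S)

  SplitsAt : List (Splitting n) → Fin n → Set
  SplitsAt S x = Any (λ s → t s ≡ x) S

  splitsAt? : ∀ S x → Dec (SplitsAt S x)
  splitsAt? S x = any? (λ s → t s ≟ x) S

  removed-⊆ : ∀ {S s a} → s ∈ₗ S → a ∈ₗ removed s → a ∈ₗ removedArcs S
  removed-⊆ (here refl) a∈ = ∈-++⁺ˡ a∈
  removed-⊆ {s′ ∷ _} (there s∈) a∈ = ∈-++⁺ʳ (removed s′) (removed-⊆ s∈ a∈)

  removed-at : ∀ d s → Any (λ a → endpoint d a ≡ t s) (removed s)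
  removed-at outgoing s = there (here refl)
  removed-at incoming s = here refl

  SplitsAt⇒arcAt : ∀ {S x} d → SplitsAt S x → Any (λ a → endpoint d a ≡ x) (removedArcs S)
  SplitsAt⇒arcAt d splits with s , s∈ , refl ← find splits
    with a , a∈ , at ← find (removed-at d s) = lose (removed-⊆ s∈ a∈) at

  degree-removedArcs : ∀ d S x → All (λ s → u s ≢ x × v s ≢ x) S →
    length (arcsAt d x (removedArcs S)) ≡ splitCount S x
  degree-removedArcs d [] x _ = refl
  degree-removedArcs outgoing (s ∷ S) x ((u≢x , _) ∷ h) with u s ≟ x
  ... | yes u≡x = ⊥-elim (u≢x u≡x)
  ... | no _ with t s ≟ x
  ...   | yes _ = cong suc (degree-removedArcs outgoing S x h)
  ...   | no _ = degree-removedArcs outgoing S x h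
  degree-removedArcs incoming (s ∷ S) x ((_ , v≢x) ∷ h) with t s ≟ x
  ... | yes _ with v s ≟ x
  ...   | yes v≡x = ⊥-elim (v≢x v≡x)
  ...   | no _ = cong suc (degree-removedArcs incoming S x h)
  degree-removedArcs incoming (s ∷ S) x ((_ , v≢x) ∷ h) | no _ with v s ≟ x
  ...   | yes v≡x = ⊥-elim (v≢x v≡x)
  ...   | no _ = degree-removedArcs incoming S x h

  splitCount-≡0 : ∀ S {x} → ¬ SplitsAt S x → splitCount S x ≡ 0
  splitCount-≡0 S unsplit = cong length (filter-none _ (All.¬Any⇒All¬ S unsplit))

  splitting-path : ∀ {X E B : Arcs n} {S} → B ↭ X ++ map added S →
    ∀ {x y} → (x , y) ∈ₗ B → Path ((X ++ E) ++ removedArcs S) x y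
  splitting-path {X} {E} B↭ xy∈ with ∈-++⁻ X (∈-resp-↭ B↭ xy∈)
  ... | inj₁ xy∈X = step (∈-++⁺ˡ (∈-++⁺ˡ xy∈X)) here
  ... | inj₂ xy∈added with s , s∈ , refl ← ∈-map⁻ added xy∈added =
    step (∈-++⁺ʳ (X ++ E) (removed-⊆ s∈ (here refl)))
      (step (∈-++⁺ʳ (X ++ E) (removed-⊆ s∈ (there (here refl)))) here)

  strong-if-attached : ∀ (V₁ : Subset n) {B L : Arcs n} →
    (∀ {a} → a ∈ₗ L → ¬ (proj₁ a ∈ V₁ × proj₂ a ∈ V₁)) →
    StrongOn (InV₂ V₁) B → (∀ {x y} → (x , y) ∈ₗ B → Path L x y) →
    (∀ d x → x ∈ V₁ → Any (λ a → endpoint d a ≡ x) L) →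
    StrongOn AllV L
  strong-if-attached V₁ {L = L} indep strongB lift attached x y _ _ _ =
    let x′ , x′∉ , x⇝x′ = exit x
        y′ , y′∉ , y′⇝y = entry y
    in x⇝x′ ++ₚ (bindPath lift (StrongOn⇒Path strongB x′∉ y′∉) ++ₚ y′⇝y)
    where
    exit : ∀ x → ∃ λ w → w ∉ V₁ × Path L x w
    exit x with x ∈? V₁
    ... | no x∉ = x , x∉ , here
    ... | yes x∈ with (_ , w) , a∈ , refl ← find (attached outgoing x x∈) =
      w , (λ w∈ → indep a∈ (x∈ , w∈)) , step a∈ here

    entry : ∀ y → ∃ λ w → w ∉ V₁ × Path L w y
    entry y with y ∈? V₁
    ... | no y∉ = y , y∉ , here
    ... | yes y∈ with (w , _) , a∈ , refl ← find (attached incoming y y∈) =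
      w , (λ w∈ → indep a∈ (w∈ , y∈)) , step a∈ here

module Construction {n : ℕ} (V₁ : Subset n) (A : Arcs n) (D : IsSplitDigraph V₁ A)
  (deg : ∀ (x : Fin n) → x ∈ V₁ → (outdeg A x ≥ 3) × (indeg A x ≥ 3))
  (ss : List (Splitting n)) (rest : Arcs n)
  (ss-valid : All (λ s → t s ∈ V₁ × u s ≢ v s) ss)
  (A↭ : A ↭ rest ++ removedArcs ss)
  (at-most-two : ∀ (x : Fin n) → x ∈ V₁ → splitCount ss x ≤ 2)
  where

  open IsSplitDigraph D

  rest-⊆ : ∀ {a} → a ∈ₗ rest → a ∈ₗ A
  rest-⊆ a∈ = ∈-resp-↭ (↭-sym A↭) (∈-++⁺ˡ a∈)

  u∉V₁ : ∀ {s} → s ∈ₗ ss → u s ∉ V₁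
  u∉V₁ s∈ u∈ = V₁-indep _ _ (∈-resp-↭ (↭-sym A↭) (∈-++⁺ʳ rest (removed-⊆ s∈ (here refl))))
                 (u∈ , proj₁ (lookup ss-valid s∈))

  v∉V₁ : ∀ {s} → s ∈ₗ ss → v s ∉ V₁
  v∉V₁ s∈ v∈ = V₁-indep _ _ (∈-resp-↭ (↭-sym A↭) (∈-++⁺ʳ rest (removed-⊆ s∈ (there (here refl)))))
                 (proj₁ (lookup ss-valid s∈) , v∈)

  inV₂? : Decidable (λ (a : Arc n) → proj₁ a ∉ V₁ × proj₂ a ∉ V₁)
  inV₂? a = ¬? (proj₁ a ∈? V₁) ×-dec ¬? (proj₂ a ∈? V₁)

  inner touching : Arcs n
  inner = filter inV₂? rest
  touching = filter (∁? inV₂?) rest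

  inducedV₂-Dstar : inducedV₂ V₁ (rest ++ map added ss) ≡ inner ++ map added ss
  inducedV₂-Dstar = ≡-trans (filter-++ inV₂? rest (map added ss))
    (cong (inner ++_) (filter-all inV₂? (All.map⁺ (tabulate (λ s∈ → u∉V₁ s∈ , v∉V₁ s∈)))))

  rest-unique : Unique rest
  rest-unique = Unique-++⁻ˡ rest (Unique-resp-↭ A↭ (proj₂ digraph))

  arcsAt-touching : ∀ d {x a} → x ∈ V₁ → a ∈ₗ arcsAt d x rest → a ∈ₗ touching
  arcsAt-touching d {x} {a} x∈ a∈ with a∈rest , refl ← arcsAt⁻ d rest a∈ =
    ∈-filter⁺ (∁? inV₂?) a∈rest (λ (∉₁ , ∉₂) → end∉ d ∉₁ ∉₂ x∈)
    where
    end∉ : ∀ d → proj₁ a ∉ V₁ → proj₂ a ∉ V₁ → endpoint d a ∉ V₁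
    end∉ outgoing ∉₁ _ = ∉₁
    end∉ incoming _ ∉₂ = ∉₂

  deg-rest+splitCount≥3 : ∀ d x → x ∈ V₁ → length (arcsAt d x rest) + splitCount ss x ≥ 3
  deg-rest+splitCount≥3 d x x∈ = subst (3 ≤_) degree-split (degree d)
    where
    degree : ∀ d → length (arcsAt d x A) ≥ 3
    degree outgoing = proj₁ (deg x x∈)
    degree incoming = proj₂ (deg x x∈)

    ends∉ : All (λ s → u s ≢ x × v s ≢ x) ss
    ends∉ = tabulate λ s∈ → (λ { refl → u∉V₁ s∈ x∈ }) , (λ { refl → v∉V₁ s∈ x∈ })

    open Relation.Binary.PropositionalEquality.≡-Reasoning
    degree-split : length (arcsAt d x A) ≡ length (arcsAt d x rest) + splitCount ss x
    degree-split = begin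
      length (arcsAt d x A)                                  ≡⟨ ↭-length (filter-↭ _ A↭) ⟩
      length (arcsAt d x (rest ++ removedArcs ss))           ≡⟨ cong length (filter-++ _ rest _) ⟩
      length (arcsAt d x rest ++ arcsAt d x (removedArcs ss)) ≡⟨ length-++ (arcsAt d x rest) ⟩
      length (arcsAt d x rest) + length (arcsAt d x (removedArcs ss))
        ≡⟨ cong (length (arcsAt d x rest) +_) (degree-removedArcs d ss x ends∉) ⟩
      length (arcsAt d x rest) + splitCount ss x              ∎

  module Lift (X₁ X₂ : Arcs n) (inner↭ : inner ↭ X₁ ++ X₂)
    (S₁ S₂ : List (Splitting n)) (ss↭ : ss ↭ S₁ ++ S₂) where

    First : Direction → Arc n → Set
    First d a = endpoint d a ∈ V₁ × ¬ SplitsAt S₁ (endpoint d a)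
              × head (arcsAt d (endpoint d a) rest) ≡ just a

    Reserved : Arc n → Set
    Reserved a = First outgoing a ⊎ First incoming a

    First⇒Reserved : ∀ d {a} → First d a → Reserved a
    First⇒Reserved outgoing = inj₁
    First⇒Reserved incoming = inj₂

    reserved? : Decidable Reserved
    reserved? a = first? outgoing ⊎-dec first? incoming
      where
      first? : ∀ d → Dec (First d a)
      first? d = endpoint d a ∈? V₁ ×-dec ¬? (splitsAt? S₁ (endpoint d a))
        ×-dec Maybe.≡-dec (Product.≡-dec _≟_ _≟_) (head (arcsAt d (endpoint d a) rest)) (just a)

    E₁ E₂ : Arcs n
    E₁ = filter reserved? touching
    E₂ = filter (∁? reserved?) touching

    A₁ A₂ : Arcs n
    A₁ = (X₁ ++ E₁) ++ removedArcs S₁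
    A₂ = (X₂ ++ E₂) ++ removedArcs S₂

    A↭A₁++A₂ : A ↭ A₁ ++ A₂
    A↭A₁++A₂ = begin
      A                                                         ↭⟨ A↭ ⟩
      rest ++ removedArcs ss
        ↭⟨ ++⁺ (↭-filter-partition inV₂? rest) (concatMap-↭ removed ss↭) ⟩
      (inner ++ touching) ++ removedArcs (S₁ ++ S₂)
        ↭⟨ ++⁺ (++⁺ inner↭ (↭-filter-partition reserved? touching))
               (↭-reflexive (concatMap-++ removed S₁ S₂)) ⟩
      ((X₁ ++ X₂) ++ (E₁ ++ E₂)) ++ (removedArcs S₁ ++ removedArcs S₂)
        ↭⟨ ++⁺ (interchange X₁ X₂ E₁ E₂) ↭-refl ⟩
      ((X₁ ++ E₁) ++ (X₂ ++ E₂)) ++ (removedArcs S₁ ++ removedArcs S₂)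
        ↭⟨ interchange (X₁ ++ E₁) (X₂ ++ E₂) _ _ ⟩
      A₁ ++ A₂                                                  ∎
      where open PermutationReasoning

    independent₁ : ∀ {a} → a ∈ₗ A₁ → ¬ (proj₁ a ∈ V₁ × proj₂ a ∈ V₁)
    independent₁ a∈ = V₁-indep _ _ (∈-resp-↭ (↭-sym A↭A₁++A₂) (∈-++⁺ˡ a∈))

    independent₂ : ∀ {a} → a ∈ₗ A₂ → ¬ (proj₁ a ∈ V₁ × proj₂ a ∈ V₁)
    independent₂ a∈ = V₁-indep _ _ (∈-resp-↭ (↭-sym A↭A₁++A₂) (∈-++⁺ʳ A₁ a∈))

    reserved-direction : ∀ {a} d → a ∈ₗ rest → Reserved a → endpoint d a ∈ V₁ → First d a
    reserved-direction {a} d a∈ reserved end∈ = [ via outgoing , via incoming ] reserved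
      where
      via : ∀ d′ → First d′ a → First d a
      via d′ first
        with refl ← endpoint-unique {P = _∈ V₁} (V₁-indep _ _ (rest-⊆ a∈)) d′ d (proj₁ first) end∈
        = first

    first-and-other-arc : ∀ d x → x ∈ V₁ → ¬ SplitsAt ss x → ∃₂ λ a b →
      head (arcsAt d x rest) ≡ just a × b ∈ₗ arcsAt d x rest × a ≢ b
    first-and-other-arc d x x∈ unsplit = second-∉-head (arcsAt d x rest) (Unique.filter⁺ _ rest-unique)
      (≤-trans (n≤1+n 2) (subst (3 ≤_) (+-identityʳ _)
        (subst (λ c → length (arcsAt d x rest) + c ≥ 3) (splitCount-≡0 ss unsplit) (deg-rest+splitCount≥3 d x x∈))))

    first-arc : ∀ d x → x ∈ V₁ → ∃ λ a → head (arcsAt d x rest) ≡ just a × a ∈ₗ arcsAt d x rest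
    first-arc d x x∈ = head-∈ (arcsAt d x rest)
      (+-cancelʳ-≤ 2 1 _ (≤-trans (deg-rest+splitCount≥3 d x x∈) (+-monoʳ-≤ _ (at-most-two x x∈))))

    attached₁ : ∀ d x → x ∈ V₁ → Any (λ a → endpoint d a ≡ x) A₁
    attached₁ d x x∈ with splitsAt? S₁ x
    ... | yes splits = Any.++⁺ʳ (X₁ ++ E₁) (SplitsAt⇒arcAt d splits)
    ... | no unsplit with a , first , a∈ ← first-arc d x x∈
      with a∈rest , refl ← arcsAt⁻ d rest a∈ =
      lose (∈-++⁺ˡ (∈-++⁺ʳ X₁ (∈-filter⁺ reserved? (arcsAt-touching d x∈ a∈) reserved))) refl
      where
      reserved : Reserved a
      reserved = First⇒Reserved d (x∈ , unsplit , first)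

    unreserved-at : ∀ d x → x ∈ V₁ → ∀ {b} → b ∈ₗ arcsAt d x rest →
      ¬ (¬ SplitsAt S₁ x × head (arcsAt d x rest) ≡ just b) → ¬ Reserved b
    unreserved-at d x x∈ b∈ notFirst reserved
      with b∈rest , refl ← arcsAt⁻ d rest b∈ =
      notFirst (proj₂ (reserved-direction d b∈rest reserved x∈))

    unreserved-arc : ∀ d x → x ∈ V₁ → ¬ SplitsAt S₂ x → ∃ λ b → b ∈ₗ arcsAt d x rest × ¬ Reserved b
    unreserved-arc d x x∈ unsplit₂ with splitsAt? S₁ x
    ... | yes splits₁ with a , _ , a∈ ← first-arc d x x∈ =
      a , a∈ , unreserved-at d x x∈ a∈ λ (unsplits₁ , _) → unsplits₁ splits₁
    ... | no unsplits₁
      with a , b , first , b∈ , a≢b ← first-and-other-arc d x x∈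
             (λ splits → [ unsplits₁ , unsplit₂ ] (Any.++⁻ S₁ (Any-resp-↭ ss↭ splits)))
      = b , b∈ , unreserved-at d x x∈ b∈
          λ (_ , first′) → a≢b (Maybe.just-injective (≡-trans (sym first) first′))

    attached₂ : ∀ d x → x ∈ V₁ → Any (λ a → endpoint d a ≡ x) A₂
    attached₂ d x x∈ with splitsAt? S₂ x
    ... | yes splits = Any.++⁺ʳ (X₂ ++ E₂) (SplitsAt⇒arcAt d splits)
    ... | no unsplit with b , b∈ , unreserved ← unreserved-arc d x x∈ unsplit
      with b∈rest , refl ← arcsAt⁻ d rest b∈ =
      lose (∈-++⁺ˡ (∈-++⁺ʳ X₂ (∈-filter⁺ (∁? reserved?) (arcsAt-touching d x∈ b∈) unreserved))) refl

    lifted-decomposition : ∀ {B₁ B₂} → B₁ ↭ X₁ ++ map added S₁ → B₂ ↭ X₂ ++ map added S₂ →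
      StrongOn (InV₂ V₁) B₁ → StrongOn (InV₂ V₁) B₂ → HasStrongArcDecomp AllV A
    lifted-decomposition B₁↭ B₂↭ strong₁ strong₂ =
      A₁ , A₂ , A↭A₁++A₂ ,
      strong-if-attached V₁ independent₁ strong₁ (splitting-path {X = X₁} {E = E₁} B₁↭) attached₁ ,
      strong-if-attached V₁ independent₂ strong₂ (splitting-path {X = X₂} {E = E₂} B₂↭) attached₂

lemma2p5 : ∀ (n : ℕ) (V₁ : Subset n) (A Dstar : Arcs n) →
    IsSplitDigraph V₁ A →
    (∀ (x : Fin n) → x ∈ V₁ → (outdeg A x ≥ 3) × (indeg A x ≥ 3)) →
    SplitOffAtMostTwo V₁ A Dstar →
    HasStrongArcDecomp (InV₂ V₁) (inducedV₂ V₁ Dstar) →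
    HasStrongArcDecomp AllV A
lemma2p5 _ V₁ A .(rest ++ map added ss) D deg (ss , rest , ss-valid , A↭ , refl , at-most-two)
  (B₁ , B₂ , induced↭ , strong₁ , strong₂) =
  let X₁ , X₂ , S₁ , S₂ , inner↭ , ss↭ , B₁↭ , B₂↭ =
        ++-map-↭-refine added inner ss (subst (_↭ B₁ ++ B₂) inducedV₂-Dstar induced↭)
  in Lift.lifted-decomposition X₁ X₂ inner↭ S₁ S₂ ss↭ B₁↭ B₂↭ strong₁ strong₂
  where open Construction V₁ A D deg ss rest ss-valid A↭ at-most-two
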